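{- Let $L_0=1$ and for $j\ge1$ \[ L_j=L_{j-1}\frac{t-t^{q^j}}{(t-\zeta^{q^{j+1}})(t-\zeta)^{q^j-q^{j-1}}(t-\zeta^q)^{q^{j-1}}}. \] Then for every $j\ge0$, \[ L_j=[1][2][3]\cdots[j]\,T^{(\sigma-1)(q^j-1)}. \]
   Context: $q$ is a prime power, $\zeta\in\mathbb F_{q^2}\setminus\mathbb F_q$, $t$ an indeterminate; computations take place in $\mathbb F_{q^2}(t)$. $T=1/(t-\zeta^q)$, $T^\sigma=1/(t-\zeta)$, and $T^{(\sigma-1)m}:=(T^\sigma/T)^m$. For $k\ge1$: $[2k]=T^{q^{2k}}-T$ and $[2k-1]=T^{q^{2k-1}}-T^{\sigma}$. The empty product is $1$. -}

module Defs where

open import Level using (Level)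
open import Algebra.Bundles using (CommutativeRing)
open import Data.Nat as ℕ using (ℕ; zero; suc; _∸_)
open import Data.Bool using (Bool; true; false; if_then_else_)
open import Data.List using (List; []; _∷_)
open import Data.List.Relation.Unary.All using (All)
open import Relation.Nullary using (¬_)
open import Data.Product using (_×_)

-- Everything is phrased inside a commutative ring R equipped with a total
-- function inv (intended as the field inverse; its laws are hypotheses of
-- the statement).
isEven : ℕ → Bool
isEven zero          = true
isEven (suc zero)    = false
isEven (suc (suc n)) = isEven n

module Setup {c ℓ : Level} (R : CommutativeRing c ℓ)
             (inv : CommutativeRing.Carrier R → CommutativeRing.Carrier R) where
  open CommutativeRing R

  pow : Carrier → ℕ → Carrier
  pow x zero    = 1#
  pow x (suc n) = x * pow x n

  fromℕ : ℕ → Carrier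
  fromℕ zero    = 0#
  fromℕ (suc n) = 1# + fromℕ n

  IsFieldInv : Set (c Level.⊔ ℓ)
  IsFieldInv = (¬ (1# ≈ 0#)) × ((x : Carrier) → ¬ (x ≈ 0#) → (x * inv x) ≈ 1#)

  evalPoly : List Carrier → Carrier → Carrier
  evalPoly []       x = 0#
  evalPoly (a ∷ as) x = a + x * evalPoly as x

  InFq2 : ℕ → Carrier → Set ℓ
  InFq2 q a = pow a (q ℕ.^ 2) ≈ a

  Transcendental : ℕ → Carrier → Set (c Level.⊔ ℓ)
  Transcendental q t = (cs : List Carrier) → All (InFq2 q) cs →
                       evalPoly cs t ≈ 0# → All (λ a → a ≈ 0#) cs

  module Objects (q : ℕ) (ζ t : Carrier) where
    T : Carrier
    T = inv (t - pow ζ q)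

    Tσ : Carrier
    Tσ = inv (t - ζ)

    -- T^{(σ-1)m} = (T^σ / T)^m
    Tσ-1 : ℕ → Carrier
    Tσ-1 m = pow (Tσ * inv T) m

    bracket : ℕ → Carrier
    bracket i = pow T (q ℕ.^ i) - (if isEven i then T else Tσ)

    brackets : ℕ → Carrier
    brackets zero    = 1#
    brackets (suc j) = brackets j * bracket (suc j)

    L : ℕ → Carrier
    L zero    = 1#
    L (suc j) = L j * ((t - pow t (q ℕ.^ suc j)) *
                  inv ((t - pow ζ (q ℕ.^ suc (suc j))) *
                       (pow (t - ζ) ((q ℕ.^ suc j) ∸ (q ℕ.^ j)) *
                        pow (t - pow ζ q) (q ℕ.^ j))))

-- Each factor L_j / L_{j-1} equals [j] T^{(σ-1)(q^j - q^{j-1})}, so the claim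
-- telescopes.  Since ζ ∈ F_{q²}, the powers ζ^{q^{j+1}} alternate between ζ and
-- ζ^q, so the term subtracted in [j] is exactly the inverse of t - ζ^{q^{j+1}}.
-- Multiplying [j] by t - ζ^{q^{j+1}} and by (t - ζ^q)^{q^j} therefore gives
-- (t - ζ^{q^{j+1}}) - (t - ζ^q)^{q^j}, and the Frobenius identity
-- (t - ζ^q)^{q^j} = t^{q^j} - ζ^{q^{j+1}} turns this into t - t^{q^j}.
module Submission where

open import Defs
open import Level using (Level)
open import Algebra.Bundles using (CommutativeRing)
open import Data.Nat using (ℕ; _≤_; _∸_; _^_)
open import Data.Nat.Primality using (Prime)
open import Relation.Binary.PropositionalEquality using (_≡_)
open import Relation.Nullary using (¬_)

open import Data.Nat as ℕ using (zero; suc; _<_; NonZero; z≤n; s≤s)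
import Data.Nat.Properties as ℕₚ
open import Data.Nat.Divisibility using (_∣_; divides; ∣⇒≤)
open import Data.Nat.Primality using (euclidsLemma; prime⇒nonZero)
open import Data.Nat.Combinatorics using (_C_; nC1≡n; nCn≡1; nCk+nC[k+1]≡[n+1]C[k+1])
import Data.Fin as Fin
open import Data.Fin.Properties using (toℕ-fromℕ; inject₁ℕ<)
open import Data.Bool using (if_then_else_)
open import Data.List using (_∷_; [])
open import Data.List.Relation.Unary.All using (_∷_; [])
open import Data.Product using (proj₁; proj₂)
open import Data.Sum using (inj₁; inj₂)
open import Data.Empty using (⊥-elim)
open import Function using (_∘_)
import Relation.Binary.PropositionalEquality as ≡

[k+1]*[n+1]C[k+1]≡[n+1]*nCk : ∀ n k → suc k ℕ.* (suc n C suc k) ≡ suc n ℕ.* (n C k)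
[k+1]*[n+1]C[k+1]≡[n+1]*nCk zero    zero    = ≡.refl
[k+1]*[n+1]C[k+1]≡[n+1]*nCk zero    (suc k) = ℕₚ.*-zeroʳ (suc (suc k))
[k+1]*[n+1]C[k+1]≡[n+1]*nCk (suc n) zero    =
  ≡.trans (ℕₚ.*-identityˡ _) (≡.trans (nC1≡n (suc (suc n))) (≡.sym (ℕₚ.*-identityʳ _)))
[k+1]*[n+1]C[k+1]≡[n+1]*nCk (suc n) (suc k) = begin
  suc (suc k) ℕ.* (suc (suc n) C suc (suc k))
    ≡⟨ ≡.cong (suc (suc k) ℕ.*_) (nCk+nC[k+1]≡[n+1]C[k+1] (suc n) (suc k)) ⟨
  suc (suc k) ℕ.* (A ℕ.+ B)
    ≡⟨ ℕₚ.*-distribˡ-+ (suc (suc k)) A B ⟩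
  A ℕ.+ suc k ℕ.* A ℕ.+ suc (suc k) ℕ.* B
    ≡⟨ ≡.cong₂ (λ u v → A ℕ.+ u ℕ.+ v) ([k+1]*[n+1]C[k+1]≡[n+1]*nCk n k)
                                     ([k+1]*[n+1]C[k+1]≡[n+1]*nCk n (suc k)) ⟩
  A ℕ.+ suc n ℕ.* (n C k) ℕ.+ suc n ℕ.* (n C suc k)
    ≡⟨ ℕₚ.+-assoc A _ _ ⟩
  A ℕ.+ (suc n ℕ.* (n C k) ℕ.+ suc n ℕ.* (n C suc k))
    ≡⟨ ≡.cong (A ℕ.+_) (ℕₚ.*-distribˡ-+ (suc n) (n C k) (n C suc k)) ⟨
  A ℕ.+ suc n ℕ.* (n C k ℕ.+ n C suc k)
    ≡⟨ ≡.cong (λ u → A ℕ.+ suc n ℕ.* u) (nCk+nC[k+1]≡[n+1]C[k+1] n k) ⟩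
  A ℕ.+ suc n ℕ.* A
    ∎
  where
  open ≡.≡-Reasoning
  A = suc n C suc k
  B = suc n C suc (suc k)

prime∣pCk : ∀ {p k} → Prime p → 0 < k → k < p → p ∣ p C k
prime∣pCk {suc n} {suc k} p-prime _ k<p
  with euclidsLemma (suc k) (suc n C suc k) p-prime
         (divides (n C k) (≡.trans ([k+1]*[n+1]C[k+1]≡[n+1]*nCk n k) (ℕₚ.*-comm (suc n) (n C k))))
... | inj₁ p∣k = ⊥-elim (ℕₚ.<⇒≱ k<p (∣⇒≤ p∣k))
... | inj₂ p∣pCk = p∣pCk

[m∸1]+[n∸m]≡n∸1 : ∀ {m n} → 1 ≤ m → m ≤ n → (m ∸ 1) ℕ.+ (n ∸ m) ≡ n ∸ 1
[m∸1]+[n∸m]≡n∸1 {m} {n} 1≤m m≤n =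
  ≡.trans (≡.sym (ℕₚ.+-∸-comm (n ∸ m) 1≤m)) (≡.cong (_∸ 1) (ℕₚ.m+[n∸m]≡n m≤n))

module _ {c ℓ} (R : CommutativeRing c ℓ)
         (inv : CommutativeRing.Carrier R → CommutativeRing.Carrier R) where

  open CommutativeRing R
  open Setup R inv
  open import Relation.Binary.Reasoning.Setoid setoid
  open import Algebra.Properties.Ring ring using ([y-z]x≈yx-zx; x+x≈x⇒x≈0)
  open import Algebra.Properties.AbelianGroup +-abelianGroup
    using (⁻¹-anti-homo‿-; inverseˡ-unique)
  open import Algebra.Properties.Monoid +-monoid using () renaming (cancelᶜ to +-cancelᶜ)
  open import Algebra.Properties.Monoid *-monoid using (elimʳ; cancelʳ; cancelˡ)
  open import Algebra.Properties.CommutativeSemigroup *-commutativeSemigroup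
    using (interchange; xy∙z≈y∙xz)
  open import Algebra.Properties.Semiring.Mult semiring using (_×_; ×-congʳ; ×-assoc-*; ×1-homo-*)
  open import Algebra.Properties.Monoid.Sum +-monoid
    using (sum; sum-init-last; sum-cong-≋; sum-replicate-zero)
  import Algebra.Properties.CommutativeSemiring.Binomial commutativeSemiring as Binomial
  open import Algebra.Properties.Semiring.Exp semiring using () renaming (_^_ to _^ᴿ_)

  pow-congˡ : ∀ {x y} n → x ≈ y → pow x n ≈ pow y n
  pow-congˡ zero    x≈y = refl
  pow-congˡ (suc n) x≈y = *-cong x≈y (pow-congˡ n x≈y)

  pow-+ : ∀ x m n → pow x (m ℕ.+ n) ≈ pow x m * pow x n
  pow-+ x zero    n = sym (*-identityˡ _)
  pow-+ x (suc m) n = trans (*-congˡ (pow-+ x m n)) (sym (*-assoc _ _ _))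

  pow-distrib-* : ∀ x y n → pow (x * y) n ≈ pow x n * pow y n
  pow-distrib-* x y zero    = sym (*-identityˡ 1#)
  pow-distrib-* x y (suc n) =
    trans (*-congˡ (pow-distrib-* x y n)) (interchange x y (pow x n) (pow y n))

  pow-1# : ∀ n → pow 1# n ≈ 1#
  pow-1# zero    = refl
  pow-1# (suc n) = trans (*-identityˡ _) (pow-1# n)

  pow-* : ∀ x m n → pow x (m ℕ.* n) ≈ pow (pow x m) n
  pow-* x zero    n = sym (pow-1# n)
  pow-* x (suc m) n = begin
    pow x (n ℕ.+ m ℕ.* n)       ≈⟨ pow-+ x n (m ℕ.* n) ⟩
    pow x n * pow x (m ℕ.* n)   ≈⟨ *-congˡ (pow-* x m n) ⟩
    pow x n * pow (pow x m) n   ≈⟨ pow-distrib-* x (pow x m) n ⟨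
    pow (x * pow x m) n         ∎

  pow≈^ : ∀ x n → pow x n ≈ x ^ᴿ n
  pow≈^ x zero    = refl
  pow≈^ x (suc n) = *-congˡ (pow≈^ x n)

  fromℕ≈×1# : ∀ n → fromℕ n ≈ n × 1#
  fromℕ≈×1# zero    = refl
  fromℕ≈×1# (suc n) = +-congˡ (fromℕ≈×1# n)

  [x-z]-[y-z]≈x-y : ∀ x y z → (x - z) - (y - z) ≈ x - y
  [x-z]-[y-z]≈x-y x y z = begin
    (x - z) - (y - z)   ≈⟨ +-congˡ (⁻¹-anti-homo‿- y z) ⟩
    (x - z) + (z - y)   ≈⟨ +-cancelᶜ (-‿inverseˡ z) x (- y) ⟩
    x - y               ∎

  [x-z]*w*y≈w-y : ∀ {x y z w} → x * y ≈ 1# → z * w ≈ 1# → ((x - z) * w) * y ≈ w - y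
  [x-z]*w*y≈w-y {x} {y} {z} {w} xy≈1 zw≈1 = begin
    ((x - z) * w) * y               ≈⟨ *-congʳ ([y-z]x≈yx-zx w x z) ⟩
    (x * w - z * w) * y             ≈⟨ [y-z]x≈yx-zx y (x * w) (z * w) ⟩
    (x * w) * y - (z * w) * y       ≈⟨ +-cong (xy∙z≈y∙xz x w y) (-‿cong (*-congʳ zw≈1)) ⟩
    w * (x * y) - 1# * y            ≈⟨ +-cong (elimʳ xy≈1 w) (-‿cong (*-identityˡ y)) ⟩
    w - y                           ∎

  IsAdditivePower : ℕ → Set (c Level.⊔ ℓ)
  IsAdditivePower n = ∀ x y → pow (x + y) n ≈ pow x n + pow y n

  isAdditivePower-* : ∀ m n → IsAdditivePower m → IsAdditivePower n →
                      IsAdditivePower (m ℕ.* n)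
  isAdditivePower-* m n additive-m additive-n x y = begin
    pow (x + y) (m ℕ.* n)                 ≈⟨ pow-* (x + y) m n ⟩
    pow (pow (x + y) m) n                 ≈⟨ pow-congˡ n (additive-m x y) ⟩
    pow (pow x m + pow y m) n             ≈⟨ additive-n (pow x m) (pow y m) ⟩
    pow (pow x m) n + pow (pow y m) n     ≈⟨ +-cong (pow-* x m n) (pow-* y m n) ⟨
    pow x (m ℕ.* n) + pow y (m ℕ.* n)     ∎

  isAdditivePower-^ : ∀ m → IsAdditivePower m → ∀ k → IsAdditivePower (m ^ k)
  isAdditivePower-^ m additive-m zero    x y =
    trans (*-identityʳ _) (sym (+-cong (*-identityʳ x) (*-identityʳ y)))
  isAdditivePower-^ m additive-m (suc k) =
    isAdditivePower-* m (m ^ k) additive-m (isAdditivePower-^ m additive-m k)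

  module _ (n : ℕ) (additive : IsAdditivePower n) where

    additivePower-0# : pow 0# n ≈ 0#
    additivePower-0# = x+x≈x⇒x≈0 (pow 0# n) (begin
      pow 0# n + pow 0# n   ≈⟨ additive 0# 0# ⟨
      pow (0# + 0#) n       ≈⟨ pow-congˡ n (+-identityˡ 0#) ⟩
      pow 0# n              ∎)

    additivePower-neg : ∀ x → pow (- x) n ≈ - pow x n
    additivePower-neg x = inverseˡ-unique (pow (- x) n) (pow x n) (begin
      pow (- x) n + pow x n   ≈⟨ additive (- x) x ⟨
      pow (- x + x) n         ≈⟨ pow-congˡ n (-‿inverseˡ x) ⟩
      pow 0# n                ≈⟨ additivePower-0# ⟩
      0#                      ∎)

    additivePower-sub : ∀ x y → pow (x - y) n ≈ pow x n - pow y n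
    additivePower-sub x y = trans (additive x (- y)) (+-congˡ (additivePower-neg y))

  ×-vanishes : ∀ {p m} → fromℕ p ≈ 0# → p ∣ m → ∀ x → m × x ≈ 0#
  ×-vanishes {p} char-p (divides r ≡.refl) x = begin
    (r ℕ.* p) × x                     ≈⟨ ×-congʳ (r ℕ.* p) (*-identityˡ x) ⟨
    (r ℕ.* p) × (1# * x)              ≈⟨ ×-assoc-* (r ℕ.* p) 1# x ⟨
    ((r ℕ.* p) × 1#) * x              ≈⟨ *-congʳ (×1-homo-* r p) ⟩
    ((r × 1#) * (p × 1#)) * x         ≈⟨ *-congʳ (*-congˡ (trans (sym (fromℕ≈×1# p)) char-p)) ⟩
    ((r × 1#) * 0#) * x               ≈⟨ *-congʳ (zeroʳ _) ⟩
    0# * x                            ≈⟨ zeroˡ x ⟩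
    0#                                ∎

  -- In the binomial expansion of (x + y)^p only the two outer terms survive.
  frobenius : ∀ {p} → Prime p → fromℕ p ≈ 0# → IsAdditivePower p
  frobenius {zero} ()
  frobenius {suc n} p-prime char-p x y = begin
    pow (x + y) p                                       ≈⟨ pow≈^ (x + y) p ⟩
    (x + y) ^ᴿ p                                        ≈⟨ Binomial.theorem p x y ⟩
    sum term                                            ≈⟨ +-congˡ (sum-init-last (term ∘ Fin.suc)) ⟩
    term Fin.zero + (sum middle + term (Fin.suc (Fin.fromℕ n)))
                                                        ≈⟨ +-cong first≈y^p (+-cong middle≈0 last≈x^p) ⟩
    y ^ᴿ p + (0# + x ^ᴿ p)                              ≈⟨ +-comm _ _ ⟩
    (0# + x ^ᴿ p) + y ^ᴿ p                              ≈⟨ +-congʳ (+-identityˡ _) ⟩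
    x ^ᴿ p + y ^ᴿ p                                     ≈⟨ +-cong (pow≈^ x p) (pow≈^ y p) ⟨
    pow x p + pow y p                                   ∎
    where
    p = suc n
    term = Binomial.binomialTerm x y p
    middle = term ∘ Fin.suc ∘ Fin.inject₁

    first≈y^p : term Fin.zero ≈ y ^ᴿ p
    first≈y^p = trans (+-identityʳ _) (*-identityˡ _)

    last≈x^p : term (Fin.suc (Fin.fromℕ n)) ≈ x ^ᴿ p
    last≈x^p rewrite toℕ-fromℕ n | nCn≡1 p | ℕₚ.n∸n≡0 n =
      trans (+-identityʳ _) (*-identityʳ _)

    middle≈0 : sum middle ≈ 0#
    middle≈0 = trans
      (sum-cong-≋ (λ i → ×-vanishes char-p (prime∣pCk p-prime (s≤s z≤n) (s≤s (inject₁ℕ< i))) _))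
      (sum-replicate-zero n)

  module _ (q : ℕ) where

    ∈Fq2-pow : ∀ {x} → InFq2 q x → ∀ n → InFq2 q (pow x n)
    ∈Fq2-pow {x} x∈F n = begin
      pow (pow x n) (q ^ 2)     ≈⟨ pow-* x n (q ^ 2) ⟨
      pow x (n ℕ.* q ^ 2)       ≡⟨ ≡.cong (pow x) (ℕₚ.*-comm n (q ^ 2)) ⟩
      pow x (q ^ 2 ℕ.* n)       ≈⟨ pow-* x (q ^ 2) n ⟩
      pow (pow x (q ^ 2)) n     ≈⟨ pow-congˡ n x∈F ⟩
      pow x n                   ∎

    ∈Fq2-neg : IsAdditivePower q → ∀ {x} → InFq2 q x → InFq2 q (- x)
    ∈Fq2-neg additive-q {x} x∈F =
      trans (additivePower-neg (q ^ 2) (isAdditivePower-^ q additive-q 2) x) (-‿cong x∈F)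

    ∈Fq2-periodic : ∀ {x} → InFq2 q x → ∀ k → pow x (q ^ (2 ℕ.+ k)) ≈ pow x (q ^ k)
    ∈Fq2-periodic {x} x∈F k = begin
      pow x (q ^ (2 ℕ.+ k))       ≡⟨ ≡.cong (pow x) (ℕₚ.^-distribˡ-+-* q 2 k) ⟩
      pow x (q ^ 2 ℕ.* q ^ k)     ≈⟨ pow-* x (q ^ 2) (q ^ k) ⟩
      pow (pow x (q ^ 2)) (q ^ k) ≈⟨ pow-congˡ (q ^ k) x∈F ⟩
      pow x (q ^ k)               ∎

    -- t - c is the value at t of the polynomial X - c over F_{q²}.
    transcendental⇒t-c≉0 : ¬ (1# ≈ 0#) → IsAdditivePower q → ∀ {t} → Transcendental q t →
                           ∀ {c} → InFq2 q c → ¬ (t - c ≈ 0#)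
    transcendental⇒t-c≉0 1≉0 additive-q {t} t-transcendental {c} c∈F t-c≈0
      with t-transcendental (- c ∷ 1# ∷ []) (∈Fq2-neg additive-q c∈F ∷ pow-1# (q ^ 2) ∷ []) (begin
        - c + t * (1# + t * 0#)   ≈⟨ +-congˡ (*-congˡ (trans (+-congˡ (zeroʳ t)) (+-identityʳ 1#))) ⟩
        - c + t * 1#              ≈⟨ +-congˡ (*-identityʳ t) ⟩
        - c + t                   ≈⟨ +-comm (- c) t ⟩
        t - c                     ≈⟨ t-c≈0 ⟩
        0#                        ∎)
    ... | _ ∷ 1≈0 ∷ [] = 1≉0 1≈0

  module _ (isField : IsFieldInv) where

    1≉0 : ¬ (1# ≈ 0#)
    1≉0 = proj₁ isField

    *-inverseʳ : ∀ {x} → ¬ (x ≈ 0#) → x * inv x ≈ 1#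
    *-inverseʳ = proj₂ isField _

    *-inverseˡ : ∀ {x} → ¬ (x ≈ 0#) → inv x * x ≈ 1#
    *-inverseˡ x≉0 = trans (*-comm _ _) (*-inverseʳ x≉0)

    *≈1⇒≉0 : ∀ {x y} → x * y ≈ 1# → ¬ (x ≈ 0#)
    *≈1⇒≉0 {x} {y} xy≈1 x≈0 = 1≉0 (begin
      1#       ≈⟨ xy≈1 ⟨
      x * y    ≈⟨ *-congʳ x≈0 ⟩
      0# * y   ≈⟨ zeroˡ y ⟩
      0#       ∎)

    inv-unique : ∀ {x y} → x * y ≈ 1# → inv x ≈ y
    inv-unique {x} {y} xy≈1 = begin
      inv x             ≈⟨ elimʳ xy≈1 (inv x) ⟨
      inv x * (x * y)   ≈⟨ cancelˡ (*-inverseˡ (*≈1⇒≉0 xy≈1)) y ⟩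
      y                 ∎

    inv-involutive : ∀ {x} → ¬ (x ≈ 0#) → inv (inv x) ≈ x
    inv-involutive x≉0 = inv-unique (*-inverseˡ x≉0)

    *-≉0 : ∀ {x y} → ¬ (x ≈ 0#) → ¬ (y ≈ 0#) → ¬ (x * y ≈ 0#)
    *-≉0 {x} {y} x≉0 y≉0 = *≈1⇒≉0 (begin
      (x * y) * (inv x * inv y)     ≈⟨ interchange x y (inv x) (inv y) ⟩
      (x * inv x) * (y * inv y)     ≈⟨ *-cong (*-inverseʳ x≉0) (*-inverseʳ y≉0) ⟩
      1# * 1#                       ≈⟨ *-identityˡ 1# ⟩
      1#                            ∎)

    pow-≉0 : ∀ {x} n → ¬ (x ≈ 0#) → ¬ (pow x n ≈ 0#)
    pow-≉0 zero    x≉0 = 1≉0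
    pow-≉0 (suc n) x≉0 = *-≉0 x≉0 (pow-≉0 n x≉0)

    pow-inverseˡ : ∀ {x} n → ¬ (x ≈ 0#) → pow (inv x) n * pow x n ≈ 1#
    pow-inverseˡ {x} n x≉0 = begin
      pow (inv x) n * pow x n   ≈⟨ pow-distrib-* (inv x) x n ⟨
      pow (inv x * x) n         ≈⟨ pow-congˡ n (*-inverseˡ x≉0) ⟩
      pow 1# n                  ≈⟨ pow-1# n ⟩
      1#                        ∎

    y*d≈x⇒x*inv[d]≈y : ∀ {x y d} → ¬ (d ≈ 0#) → y * d ≈ x → x * inv d ≈ y
    y*d≈x⇒x*inv[d]≈y {x} {y} {d} d≉0 yd≈x = begin
      x * inv d         ≈⟨ *-congʳ yd≈x ⟨
      (y * d) * inv d   ≈⟨ cancelʳ (*-inverseʳ d≉0) y ⟩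
      y                 ∎

    module _ (q : ℕ) .{{_ : NonZero q}} (additive-q : IsAdditivePower q)
             (ζ t : Carrier) (ζ∈F : InFq2 q ζ)
             (t-c≉0 : ∀ {c} → InFq2 q c → ¬ (t - c ≈ 0#)) where

      open Objects q ζ t

      t-ζ≉0 : ¬ (t - ζ ≈ 0#)
      t-ζ≉0 = t-c≉0 ζ∈F

      t-ζ^q≉0 : ¬ (t - pow ζ q ≈ 0#)
      t-ζ^q≉0 = t-c≉0 (∈Fq2-pow q ζ∈F q)

      Tσ-1≈Tσ^n*[t-ζ^q]^n : ∀ n → Tσ-1 n ≈ pow Tσ n * pow (t - pow ζ q) n
      Tσ-1≈Tσ^n*[t-ζ^q]^n n =
        trans (pow-distrib-* Tσ (inv T) n) (*-congˡ (pow-congˡ n (inv-involutive t-ζ^q≉0)))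

      -- The parity test in [i] matches the alternation ζ^{q^{i+1}} ∈ {ζ^q, ζ}.
      subtrahend-inverse : ∀ i → (if isEven i then T else Tσ) * (t - pow ζ (q ^ suc i)) ≈ 1#
      subtrahend-inverse zero =
        trans (*-congˡ (+-congˡ (-‿cong (reflexive (≡.cong (pow ζ) (ℕₚ.*-identityʳ q))))))
              (*-inverseˡ t-ζ^q≉0)
      subtrahend-inverse (suc zero) = trans (*-congˡ (+-congˡ (-‿cong ζ∈F))) (*-inverseˡ t-ζ≉0)
      subtrahend-inverse (suc (suc i)) =
        trans (*-congˡ (+-congˡ (-‿cong (∈Fq2-periodic q ζ∈F (suc i))))) (subtrahend-inverse i)

      denominator : ℕ → Carrier
      denominator j = (t - pow ζ (q ^ suc (suc j))) *
                      (pow (t - ζ) ((q ^ suc j) ∸ (q ^ j)) * pow (t - pow ζ q) (q ^ j))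

      Tσ-1*powers : ∀ {m n} → m ≤ n → Tσ-1 (n ∸ m) * (pow (t - ζ) (n ∸ m) * pow (t - pow ζ q) m) ≈
                                      pow (t - pow ζ q) n
      Tσ-1*powers {m} {n} m≤n = begin
        Tσ-1 k * (pow (t - ζ) k * pow (t - pow ζ q) m)
          ≈⟨ *-congʳ (Tσ-1≈Tσ^n*[t-ζ^q]^n k) ⟩
        (pow Tσ k * pow (t - pow ζ q) k) * (pow (t - ζ) k * pow (t - pow ζ q) m)
          ≈⟨ interchange (pow Tσ k) _ (pow (t - ζ) k) _ ⟩
        (pow Tσ k * pow (t - ζ) k) * (pow (t - pow ζ q) k * pow (t - pow ζ q) m)
          ≈⟨ *-cong (pow-inverseˡ k t-ζ≉0) (sym (pow-+ (t - pow ζ q) k m)) ⟩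
        1# * pow (t - pow ζ q) (k ℕ.+ m)
          ≈⟨ *-identityˡ _ ⟩
        pow (t - pow ζ q) (k ℕ.+ m)
          ≡⟨ ≡.cong (pow (t - pow ζ q)) (ℕₚ.m∸n+n≡m m≤n) ⟩
        pow (t - pow ζ q) n
          ∎
        where k = n ∸ m

      bracket*denominator : ∀ j → (bracket (suc j) * Tσ-1 (q ^ suc j ∸ q ^ j)) * denominator j ≈
                                  t - pow t (q ^ suc j)
      bracket*denominator j = begin
        (bracket (suc j) * Tσ-1 (Q ∸ m)) * (e * powers)
          ≈⟨ interchange (bracket (suc j)) _ e powers ⟩
        (bracket (suc j) * e) * (Tσ-1 (Q ∸ m) * powers)
          ≈⟨ *-congˡ (Tσ-1*powers (ℕₚ.m≤n*m m q)) ⟩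
        ((pow T Q - s) * e) * pow (t - pow ζ q) Q
          ≈⟨ [x-z]*w*y≈w-y (pow-inverseˡ Q t-ζ^q≉0) (subtrahend-inverse (suc j)) ⟩
        e - pow (t - pow ζ q) Q
          ≈⟨ +-congˡ (-‿cong (additivePower-sub Q (isAdditivePower-^ q additive-q (suc j)) t (pow ζ q))) ⟩
        e - (pow t Q - pow (pow ζ q) Q)
          ≈⟨ +-congˡ (-‿cong (+-congˡ (-‿cong (pow-* ζ q Q)))) ⟨
        (t - pow ζ (q ^ suc (suc j))) - (pow t Q - pow ζ (q ^ suc (suc j)))
          ≈⟨ [x-z]-[y-z]≈x-y t (pow t Q) _ ⟩
        t - pow t Q
          ∎
        where
        Q = q ^ suc j
        m = q ^ j
        s = if isEven (suc j) then T else Tσ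
        e = t - pow ζ (q ^ suc (suc j))
        powers = pow (t - ζ) (Q ∸ m) * pow (t - pow ζ q) m

      denominator≉0 : ∀ j → ¬ (denominator j ≈ 0#)
      denominator≉0 j = *-≉0 (t-c≉0 (∈Fq2-pow q ζ∈F (q ^ suc (suc j))))
                             (*-≉0 (pow-≉0 (q ^ suc j ∸ q ^ j) t-ζ≉0) (pow-≉0 (q ^ j) t-ζ^q≉0))

      L≈brackets*Tσ-1 : ∀ j → L j ≈ brackets j * Tσ-1 (q ^ j ∸ 1)
      L≈brackets*Tσ-1 zero    = sym (*-identityˡ 1#)
      L≈brackets*Tσ-1 (suc j) = begin
        L j * ((t - pow t Q) * inv (denominator j))
          ≈⟨ *-cong (L≈brackets*Tσ-1 j) (y*d≈x⇒x*inv[d]≈y (denominator≉0 j) (bracket*denominator j)) ⟩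
        (brackets j * Tσ-1 (m ∸ 1)) * (bracket (suc j) * Tσ-1 (Q ∸ m))
          ≈⟨ interchange (brackets j) (Tσ-1 (m ∸ 1)) (bracket (suc j)) (Tσ-1 (Q ∸ m)) ⟩
        brackets (suc j) * (Tσ-1 (m ∸ 1) * Tσ-1 (Q ∸ m))
          ≈⟨ *-congˡ (pow-+ (Tσ * inv T) (m ∸ 1) (Q ∸ m)) ⟨
        brackets (suc j) * Tσ-1 ((m ∸ 1) ℕ.+ (Q ∸ m))
          ≡⟨ ≡.cong (λ k → brackets (suc j) * Tσ-1 k)
                    ([m∸1]+[n∸m]≡n∸1 (ℕₚ.m^n>0 q j) (ℕₚ.m≤n*m m q)) ⟩
        brackets (suc j) * Tσ-1 (Q ∸ 1)
          ∎
        where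
        Q = q ^ suc j
        m = q ^ j

lemma3p4 : {c ℓ : Level} (R : CommutativeRing c ℓ)
    (inv : CommutativeRing.Carrier R → CommutativeRing.Carrier R) →
    Setup.IsFieldInv R inv →
    (p e q : ℕ) → Prime p → 1 ≤ e → q ≡ p ^ e →
    CommutativeRing._≈_ R (Setup.fromℕ R inv p) (CommutativeRing.0# R) →
    (ζ t : CommutativeRing.Carrier R) →
    Setup.InFq2 R inv q ζ →
    ¬ CommutativeRing._≈_ R (Setup.pow R inv ζ q) ζ →
    Setup.Transcendental R inv q t →
    (j : ℕ) →
    CommutativeRing._≈_ R (Setup.Objects.L R inv q ζ t j)
      (CommutativeRing._*_ R (Setup.Objects.brackets R inv q ζ t j)
                             (Setup.Objects.Tσ-1 R inv q ζ t ((q ^ j) ∸ 1)))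
lemma3p4 R inv isField p e q p-prime _ ≡.refl char-p ζ t ζ∈F _ t-transcendental =
  L≈brackets*Tσ-1 R inv isField q {{q≢0}} additive-q ζ t ζ∈F
    (transcendental⇒t-c≉0 R inv (p ^ e) (1≉0 R inv isField) additive-q t-transcendental)
  where
  q≢0 : NonZero (p ^ e)
  q≢0 = ℕₚ.m^n≢0 p e {{prime⇒nonZero p-prime}}

  additive-q : IsAdditivePower R inv (p ^ e)
  additive-q = isAdditivePower-^ R inv p (frobenius R inv p-prime char-p) e
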